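{- Let $U\in\mathcal{P}(n,d)$, let $L^{tr}=\mathbf{e}^d\mathbf{n}^{n-d}$, and set \[ \mathcal{S}=\{\operatorname{st}(C):C\in\mathcal{P}[U,L^{tr}]\},\quad \mathcal{S}^{\mathbf{e}}=\{\operatorname{st}(C):C\in\mathcal{P}[U,L^{tr}]^{\mathbf{e}}_\circ\},\quad \mathcal{S}^{\mathbf{n}}=\{\operatorname{st}(C):C\in\mathcal{P}[U,L^{tr}]^{\mathbf{n}}_\circ\}. \] Then $\mathcal{S}=\mathcal{S}^{\mathbf{e}}\cup\mathcal{S}^{\mathbf{n}}\cup\big(n\ast(\mathcal{S}^{\mathbf{e}}\cap\mathcal{S}^{\mathbf{n}})\big)$.
   Context: $\mathcal{P}(n,d)$ is the set of words of length $n$ in $\mathbf{e}$ and $\mathbf{n}$ with exactly $d$ letters $\mathbf{e}$ (lattice paths from $(0,0)$ to $(d,n-d)$). $U$ weakly above $L$ means every prefix of $L$ has at least as many $\mathbf{e}$'s as the equally long prefix of $U$; $\mathcal{P}[U,L]$ is the set of paths weakly below $U$ and weakly above $L$. $\mathcal{P}[U,L]^{\mathbf{e}}_\circ$ (resp. $\mathcal{P}[U,L]^{\mathbf{n}}_\circ$) is the set of words of length $n-1$ obtained from the paths in $\mathcal{P}[U,L]$ whose last letter is $\mathbf{e}$ (resp. $\mathbf{n}$) by deleting that last letter. For any word $C$ in $\{\mathbf{e},\mathbf{n}\}$, scan positions left to right and mark position $i$ with $C_i=\mathbf{e}$ if the number of $\mathbf{n}$'s at positions $<i$ equals the number of unmarked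 $\mathbf{e}$'s at positions $<i$; $\operatorname{st}(C)$ is the set of positions of unmarked $\mathbf{e}$'s. For a family $K$ of sets and $v$ not in any of them, $v\ast K=K\cup\{\sigma\cup\{v\}:\sigma\in K\}$. -}

module Defs where

open import Data.Nat using (ℕ; zero; suc; _≤_; _∸_)
open import Data.Nat.Properties using (_≟_)
open import Data.List using (List; []; _∷_; length; take; replicate; _++_; [_])
open import Data.List.Membership.Propositional using (_∈_)
open import Data.Product using (Σ; _×_; ∃)
open import Relation.Binary.PropositionalEquality using (_≡_)
open import Relation.Nullary using (yes; no)
open import Function.Bundles using (_⇔_)

-- letters e (east) and n (north)
data Step : Set where
  𝐞 𝐧 : Step

Word : Set
Word = List Step

#e : Word → ℕ
#e [] = 0
#e (𝐞 ∷ w) = suc (#e w)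
#e (𝐧 ∷ w) = #e w

InP : ℕ → ℕ → Word → Set
InP n d w = (length w ≡ n) × (#e w ≡ d)

WeaklyAbove : Word → Word → Set
WeaklyAbove U L = ∀ k → #e (take k U) ≤ #e (take k L)

InInterval : ℕ → ℕ → Word → Word → Word → Set
InInterval n d U L P = InP n d P × WeaklyAbove U P × WeaklyAbove P L

-- 𝒫[U,L]^e_∘ and 𝒫[U,L]^n_∘ : delete the last letter
InIntervalE : ℕ → ℕ → Word → Word → Word → Set
InIntervalE n d U L C = InInterval n d U L (C ++ [ 𝐞 ])

InIntervalN : ℕ → ℕ → Word → Word → Word → Set
InIntervalN n d U L C = InInterval n d U L (C ++ [ 𝐧 ])

-- st(C): positions (1-indexed) of unmarked e's.
stAux : ℕ → ℕ → ℕ → Word → List ℕ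
stAux i cn ue [] = []
stAux i cn ue (𝐧 ∷ w) = stAux (suc i) (suc cn) ue w
stAux i cn ue (𝐞 ∷ w) with cn ≟ ue
... | yes _ = stAux (suc i) cn ue w
... | no  _ = i ∷ stAux (suc i) cn (suc ue) w

st : Word → List ℕ
st = stAux 1 0 0

-- finite sets of naturals are represented by lists; two lists represent
-- the same set iff they have the same elements
_≈ˢ_ : List ℕ → List ℕ → Set
A ≈ˢ B = ∀ x → (x ∈ A) ⇔ (x ∈ B)

Ltr : ℕ → ℕ → Word
Ltr n d = replicate d 𝐞 ++ replicate (n ∸ d) 𝐧

InS : ℕ → ℕ → Word → List ℕ → Set
InS n d U X = Σ Word λ C → InInterval n d U (Ltr n d) C × (st C ≈ˢ X)

InSe : ℕ → ℕ → Word → List ℕ → Set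
InSe n d U X = Σ Word λ C → InIntervalE n d U (Ltr n d) C × (st C ≈ˢ X)

InSn : ℕ → ℕ → Word → List ℕ → Set
InSn n d U X = Σ Word λ C → InIntervalN n d U (Ltr n d) C × (st C ≈ˢ X)

-- Read st through the height h = #n − #(unmarked e) of the scanned prefix: an e is
-- marked exactly when read at height 0, and otherwise lowers the height.  Every path of
-- 𝒫(n,d) lies above L^tr.  Dropping a final n, or a final e read at height 0, keeps st;
-- a final e read at positive height contributes n.  In that last case the prefix C also
-- lies in 𝒮ⁿ: turning into an e the last n of C at which the height leaves 0 keeps st
-- (the rest of the walk stays positive) and raises the path.  Conversely, if st(A) = st(B)
-- with Ae, Bn admissible, counting n's gives height(A) = height(B) + 1 > 0.
module Submission where

open import Defs
open import Data.Nat using (ℕ; zero; suc; pred; _+_; _∸_; _⊓_; _≤_; _<_; z≤n; s≤s)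
open import Data.Nat.Properties
open import Data.List using (List; []; _∷_; length; take; replicate; _++_; [_]; _∷ʳ_; _∷ʳ′_; initLast)
open import Data.List.Properties using (length-++; ++-identityʳ)
open import Data.List.Membership.Propositional using (_∈_)
open import Data.List.Relation.Unary.Any using (here; there)
open import Data.List.Relation.Unary.Any.Properties using (++-comm)
open import Data.List.Relation.Unary.All as All using (All; []; _∷_)
open import Data.List.Relation.Unary.AllPairs using (AllPairs; []; _∷_)
open import Data.Product using (Σ; _×_; _,_; proj₁)
open import Data.Sum using (_⊎_; inj₁; inj₂)
open import Function.Bundles using (_⇔_; mk⇔; Equivalence)
import Function.Properties.Equivalence as ⇔
open import Relation.Binary.PropositionalEquality hiding ([_])
open import Relation.Nullary using (yes; no; contradiction)

open Equivalence

#e-∷ʳ-𝐞 : ∀ w → #e (w ∷ʳ 𝐞) ≡ suc (#e w)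
#e-∷ʳ-𝐞 [] = refl
#e-∷ʳ-𝐞 (𝐞 ∷ w) = cong suc (#e-∷ʳ-𝐞 w)
#e-∷ʳ-𝐞 (𝐧 ∷ w) = #e-∷ʳ-𝐞 w

#e-∷ʳ-𝐧 : ∀ w → #e (w ∷ʳ 𝐧) ≡ #e w
#e-∷ʳ-𝐧 [] = refl
#e-∷ʳ-𝐧 (𝐞 ∷ w) = cong suc (#e-∷ʳ-𝐧 w)
#e-∷ʳ-𝐧 (𝐧 ∷ w) = #e-∷ʳ-𝐧 w

#n : Word → ℕ
#n [] = 0
#n (𝐞 ∷ w) = #n w
#n (𝐧 ∷ w) = suc (#n w)

#e+#n≡length : ∀ w → #e w + #n w ≡ length w
#e+#n≡length [] = refl
#e+#n≡length (𝐞 ∷ w) = cong suc (#e+#n≡length w)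
#e+#n≡length (𝐧 ∷ w) = trans (+-suc (#e w) (#n w)) (cong suc (#e+#n≡length w))

length-∷ʳ : ∀ (w : Word) x → length (w ∷ʳ x) ≡ suc (length w)
length-∷ʳ w x = trans (length-++ w) (+-comm (length w) 1)

height : ℕ → Word → ℕ
height h [] = h
height h (𝐧 ∷ w) = height (suc h) w
height h (𝐞 ∷ w) = height (pred h) w

stAt : ℕ → ℕ → Word → List ℕ
stAt i h [] = []
stAt i h (𝐧 ∷ w) = stAt (suc i) (suc h) w
stAt i zero (𝐞 ∷ w) = stAt (suc i) zero w
stAt i (suc h) (𝐞 ∷ w) = i ∷ stAt (suc i) h w

stAux≡stAt : ∀ i {cn ue} w → ue ≤ cn → stAux i cn ue w ≡ stAt i (cn ∸ ue) w
stAux≡stAt i [] ue≤cn = refl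
stAux≡stAt i (𝐧 ∷ w) ue≤cn =
  trans (stAux≡stAt (suc i) w (m≤n⇒m≤1+n ue≤cn))
        (cong (λ h → stAt (suc i) h w) (+-∸-assoc 1 ue≤cn))
stAux≡stAt i {cn} {ue} (𝐞 ∷ w) ue≤cn with cn ≟ ue
... | yes refl rewrite n∸n≡0 cn =
  trans (stAux≡stAt (suc i) w ue≤cn) (cong (λ h → stAt (suc i) h w) (n∸n≡0 cn))
... | no cn≢ue with ≤∧≢⇒< ue≤cn (λ ue≡cn → cn≢ue (sym ue≡cn))
...   | ue<cn rewrite +-∸-assoc 1 ue<cn = cong (i ∷_) (stAux≡stAt (suc i) w ue<cn)

st≡stAt : ∀ w → st w ≡ stAt 1 0 w
st≡stAt w = stAux≡stAt 1 w z≤n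

stAt-++ : ∀ i h w v → stAt i h (w ++ v) ≡ stAt i h w ++ stAt (i + length w) (height h w) v
stAt-++ i h [] v rewrite +-identityʳ i = refl
stAt-++ i h (𝐧 ∷ w) v rewrite +-suc i (length w) = stAt-++ (suc i) (suc h) w v
stAt-++ i zero (𝐞 ∷ w) v rewrite +-suc i (length w) = stAt-++ (suc i) zero w v
stAt-++ i (suc h) (𝐞 ∷ w) v rewrite +-suc i (length w) = cong (i ∷_) (stAt-++ (suc i) h w v)

st-∷ʳ : ∀ w x → st (w ∷ʳ x) ≡ st w ++ stAt (suc (length w)) (height 0 w) [ x ]
st-∷ʳ w x rewrite st≡stAt (w ∷ʳ x) | st≡stAt w = stAt-++ 1 0 w [ x ]

st-∷ʳ-𝐧 : ∀ w → st (w ∷ʳ 𝐧) ≡ st w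
st-∷ʳ-𝐧 w = trans (st-∷ʳ w 𝐧) (++-identityʳ (st w))

st-∷ʳ-𝐞-marked : ∀ w → height 0 w ≡ 0 → st (w ∷ʳ 𝐞) ≡ st w
st-∷ʳ-𝐞-marked w hw rewrite st-∷ʳ w 𝐞 | hw = ++-identityʳ (st w)

st-∷ʳ-𝐞-unmarked : ∀ w {h} → height 0 w ≡ suc h → st (w ∷ʳ 𝐞) ≡ st w ∷ʳ suc (length w)
st-∷ʳ-𝐞-unmarked w hw rewrite st-∷ʳ w 𝐞 | hw = refl

≈ˢ-refl : ∀ {A} → A ≈ˢ A
≈ˢ-refl x = ⇔.refl

≈ˢ-sym : ∀ {A B} → A ≈ˢ B → B ≈ˢ A
≈ˢ-sym A≈B x = ⇔.sym (A≈B x)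

≈ˢ-trans : ∀ {A B C} → A ≈ˢ B → B ≈ˢ C → A ≈ˢ C
≈ˢ-trans A≈B B≈C x = ⇔.trans (A≈B x) (B≈C x)

≈ˢ-∷ʳ : ∀ A a → (A ∷ʳ a) ≈ˢ (a ∷ A)
≈ˢ-∷ʳ A a x = mk⇔ (++-comm A [ a ]) (++-comm [ a ] A)

≈ˢ-∷ : ∀ a {A B} → A ≈ˢ B → (a ∷ A) ≈ˢ (a ∷ B)
≈ˢ-∷ a A≈B x = mk⇔ (∷-map (to (A≈B x))) (∷-map (from (A≈B x)))
  where
  ∷-map : ∀ {A B} → (x ∈ A → x ∈ B) → x ∈ a ∷ A → x ∈ a ∷ B
  ∷-map f (here x≡a) = here x≡a
  ∷-map f (there x∈A) = there (f x∈A)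

stAt-≥ : ∀ i h w → All (i ≤_) (stAt i h w)
stAt-≥ i h [] = []
stAt-≥ i h (𝐧 ∷ w) = All.map <⇒≤ (stAt-≥ (suc i) (suc h) w)
stAt-≥ i zero (𝐞 ∷ w) = All.map <⇒≤ (stAt-≥ (suc i) zero w)
stAt-≥ i (suc h) (𝐞 ∷ w) = ≤-refl ∷ All.map <⇒≤ (stAt-≥ (suc i) h w)

stAt-increasing : ∀ i h w → AllPairs _<_ (stAt i h w)
stAt-increasing i h [] = []
stAt-increasing i h (𝐧 ∷ w) = stAt-increasing (suc i) (suc h) w
stAt-increasing i zero (𝐞 ∷ w) = stAt-increasing (suc i) zero w
stAt-increasing i (suc h) (𝐞 ∷ w) = stAt-≥ (suc i) h w ∷ stAt-increasing (suc i) h w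

∈-tail : ∀ {x y A B} → All (x <_) A → y ∈ A → y ∈ x ∷ B → y ∈ B
∈-tail x<A y∈A (here refl) = contradiction (All.lookup x<A y∈A) (<-irrefl refl)
∈-tail x<A y∈A (there y∈B) = y∈B

increasing-≈ˢ⇒≡ : ∀ {A B} → AllPairs _<_ A → AllPairs _<_ B → A ≈ˢ B → A ≡ B
increasing-≈ˢ⇒≡ [] [] A≈B = refl
increasing-≈ˢ⇒≡ [] (_∷_ {y} _ _) A≈B with () ← from (A≈B y) (here refl)
increasing-≈ˢ⇒≡ (_∷_ {x} _ _) [] A≈B with () ← to (A≈B x) (here refl)
increasing-≈ˢ⇒≡ {x ∷ A} {y ∷ B} (x<A ∷ A↑) (y<B ∷ B↑) A≈B =
  cong₂ _∷_ x≡y (increasing-≈ˢ⇒≡ A↑ B↑ tails)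
  where
  x≡y : x ≡ y
  x≡y with to (A≈B x) (here refl) | from (A≈B y) (here refl)
  ... | here x≡y | _ = x≡y
  ... | there _ | here y≡x = sym y≡x
  ... | there x∈B | there y∈A = contradiction (All.lookup x<A y∈A) (<-asym (All.lookup y<B x∈B))
  tails : A ≈ˢ B
  tails z = mk⇔ (λ z∈A → ∈-tail (subst (λ m → All (m <_) A) x≡y x<A) z∈A (to (A≈B z) (there z∈A)))
                (λ z∈B → ∈-tail (subst (λ m → All (m <_) B) (sym x≡y) y<B) z∈B (from (A≈B z) (there z∈B)))

st-≈ˢ⇒≡ : ∀ A B → st A ≈ˢ st B → st A ≡ st B
st-≈ˢ⇒≡ A B rewrite st≡stAt A | st≡stAt B =
  increasing-≈ˢ⇒≡ (stAt-increasing 1 0 A) (stAt-increasing 1 0 B)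

h+#n≡height+length-stAt : ∀ i h w → h + #n w ≡ height h w + length (stAt i h w)
h+#n≡height+length-stAt i h [] = refl
h+#n≡height+length-stAt i h (𝐧 ∷ w) = trans (+-suc h (#n w)) (h+#n≡height+length-stAt (suc i) (suc h) w)
h+#n≡height+length-stAt i zero (𝐞 ∷ w) = h+#n≡height+length-stAt (suc i) zero w
h+#n≡height+length-stAt i (suc h) (𝐞 ∷ w) =
  trans (cong suc (h+#n≡height+length-stAt (suc i) h w)) (sym (+-suc _ _))

#n≡height+length-st : ∀ w → #n w ≡ height 0 w + length (st w)
#n≡height+length-st w rewrite st≡stAt w = h+#n≡height+length-stAt 1 0 w

height-gap : ∀ {m d} A B → InP m d (A ∷ʳ 𝐞) → InP m d (B ∷ʳ 𝐧) → st A ≈ˢ st B →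
             height 0 A ≡ suc (height 0 B)
height-gap A B (lenA , #eA) (lenB , #eB) stA≈stB = +-cancelʳ-≡ _ _ _ (begin
  height 0 A + length (st A)        ≡⟨ sym (#n≡height+length-st A) ⟩
  #n A                              ≡⟨ #nA≡1+#nB ⟩
  suc (#n B)                        ≡⟨ cong suc (#n≡height+length-st B) ⟩
  suc (height 0 B + length (st B))  ≡⟨ cong (λ l → suc (height 0 B + l)) (cong length (sym (st-≈ˢ⇒≡ A B stA≈stB))) ⟩
  suc (height 0 B) + length (st A)  ∎)
  where
  open ≡-Reasoning
  #eB≡1+#eA : #e B ≡ suc (#e A)
  #eB≡1+#eA = trans (sym (#e-∷ʳ-𝐧 B)) (trans #eB (trans (sym #eA) (#e-∷ʳ-𝐞 A)))
  #nA≡1+#nB : #n A ≡ suc (#n B)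
  #nA≡1+#nB = +-cancelˡ-≡ (#e A) _ _ (begin
    #e A + #n A        ≡⟨ #e+#n≡length A ⟩
    length A           ≡⟨ suc-injective (trans (sym (length-∷ʳ A 𝐞)) (trans lenA (trans (sym lenB) (length-∷ʳ B 𝐧)))) ⟩
    length B           ≡⟨ sym (#e+#n≡length B) ⟩
    #e B + #n B        ≡⟨ cong (_+ #n B) #eB≡1+#eA ⟩
    suc (#e A) + #n B  ≡⟨ sym (+-suc (#e A) (#n B)) ⟩
    #e A + suc (#n B)  ∎)

#e-take≤ : ∀ k w → #e (take k w) ≤ k ⊓ #e w
#e-take≤ zero w = z≤n
#e-take≤ (suc k) [] = z≤n
#e-take≤ (suc k) (𝐞 ∷ w) = s≤s (#e-take≤ k w)
#e-take≤ (suc k) (𝐧 ∷ w) = ≤-trans (#e-take≤ k w) (⊓-monoˡ-≤ (#e w) (n≤1+n k))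

#e-take-replicate : ∀ k d r → k ⊓ d ≤ #e (take k (replicate d 𝐞 ++ r))
#e-take-replicate zero d r = z≤n
#e-take-replicate (suc k) zero r = z≤n
#e-take-replicate (suc k) (suc d) r = s≤s (#e-take-replicate k d r)

weaklyAbove-Ltr : ∀ {n d} P → InP n d P → WeaklyAbove P (Ltr n d)
weaklyAbove-Ltr {d = d} P (_ , #eP) k =
  ≤-trans (#e-take≤ k P) (subst (λ e → k ⊓ e ≤ _) (sym #eP) (#e-take-replicate k d _))

-- StaysPositive h w: the walk w, started at height suc h, never comes down to 0.
data StaysPositive : ℕ → Word → Set where
  end  : ∀ {h} → StaysPositive h []
  up   : ∀ {h w} → StaysPositive (suc h) w → StaysPositive h (𝐧 ∷ w)
  down : ∀ {h w} → StaysPositive h w → StaysPositive (suc h) (𝐞 ∷ w)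

stAt-shift : ∀ {i h w} → StaysPositive h w → stAt i (suc h) w ≡ stAt i h w
stAt-shift end = refl
stAt-shift (up w⁺) = stAt-shift w⁺
stAt-shift {i} (down w⁺) = cong (i ∷_) (stAt-shift w⁺)

data RiseView : ℕ → Word → Set where
  positive : ∀ {h w} → StaysPositive h w → RiseView (suc h) w
  lastRise : ∀ {h} p {q} → height h p ≡ 0 → StaysPositive 0 q → RiseView h (p ++ 𝐧 ∷ q)

riseView : ∀ h w → 1 ≤ height h w → RiseView h w
riseView zero [] ()
riseView (suc h) [] _ = positive end
riseView zero (𝐧 ∷ w) h⁺ with riseView 1 w h⁺
... | positive w⁺ = lastRise [] refl w⁺
... | lastRise p hp q⁺ = lastRise (𝐧 ∷ p) hp q⁺
riseView (suc h) (𝐧 ∷ w) h⁺ with riseView (suc (suc h)) w h⁺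
... | positive w⁺ = positive (up w⁺)
... | lastRise p hp q⁺ = lastRise (𝐧 ∷ p) hp q⁺
riseView zero (𝐞 ∷ w) h⁺ with riseView zero w h⁺
... | lastRise p hp q⁺ = lastRise (𝐞 ∷ p) hp q⁺
riseView (suc h) (𝐞 ∷ w) h⁺ with riseView h w h⁺
... | positive w⁺ = positive (down w⁺)
... | lastRise p hp q⁺ = lastRise (𝐞 ∷ p) hp q⁺

st-flip : ∀ p q → height 0 p ≡ 0 → StaysPositive 0 q → st (p ++ 𝐞 ∷ q) ≡ st (p ++ 𝐧 ∷ q)
st-flip p q hp q⁺
  rewrite st≡stAt (p ++ 𝐞 ∷ q) | st≡stAt (p ++ 𝐧 ∷ q)
        | stAt-++ 1 0 p (𝐞 ∷ q) | stAt-++ 1 0 p (𝐧 ∷ q) | hp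
  = cong (stAt 1 0 p ++_) (sym (stAt-shift q⁺))

length-flip : ∀ p q {x x′ y y′} → length ((p ++ x ∷ q) ∷ʳ y) ≡ length ((p ++ x′ ∷ q) ∷ʳ y′)
length-flip [] q = cong suc (trans (length-∷ʳ q _) (sym (length-∷ʳ q _)))
length-flip (_ ∷ p) q = cong suc (length-flip p q)

#e-flip : ∀ p q → #e ((p ++ 𝐞 ∷ q) ∷ʳ 𝐧) ≡ #e ((p ++ 𝐧 ∷ q) ∷ʳ 𝐞)
#e-flip [] q = trans (cong suc (#e-∷ʳ-𝐧 q)) (sym (#e-∷ʳ-𝐞 q))
#e-flip (𝐞 ∷ p) q = cong suc (#e-flip p q)
#e-flip (𝐧 ∷ p) q = #e-flip p q

#e-take-∷ʳ : ∀ k w → #e (take k (w ∷ʳ 𝐞)) ≤ suc (#e (take k (w ∷ʳ 𝐧)))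
#e-take-∷ʳ zero w = z≤n
#e-take-∷ʳ (suc k) [] = ≤-refl
#e-take-∷ʳ (suc k) (𝐞 ∷ w) = s≤s (#e-take-∷ʳ k w)
#e-take-∷ʳ (suc k) (𝐧 ∷ w) = #e-take-∷ʳ k w

flip-weaklyAbove : ∀ p q → WeaklyAbove ((p ++ 𝐧 ∷ q) ∷ʳ 𝐞) ((p ++ 𝐞 ∷ q) ∷ʳ 𝐧)
flip-weaklyAbove p q zero = z≤n
flip-weaklyAbove [] q (suc k) = #e-take-∷ʳ k q
flip-weaklyAbove (𝐞 ∷ p) q (suc k) = s≤s (flip-weaklyAbove p q k)
flip-weaklyAbove (𝐧 ∷ p) q (suc k) = flip-weaklyAbove p q k

module _ {n d : ℕ} {U : Word} where

  inInterval-Ltr : ∀ {P} → InP n d P → WeaklyAbove U P → InInterval n d U (Ltr n d) P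
  inInterval-Ltr P∈𝒫 U≥P = P∈𝒫 , U≥P , weaklyAbove-Ltr _ P∈𝒫

  flip-inInterval : ∀ p q → InIntervalE n d U (Ltr n d) (p ++ 𝐧 ∷ q) →
                    InIntervalN n d U (Ltr n d) (p ++ 𝐞 ∷ q)
  flip-inInterval p q ((len , #e≡d) , U≥C , _) =
    inInterval-Ltr (trans (length-flip p q) len , trans (#e-flip p q) #e≡d)
                   (λ k → ≤-trans (U≥C k) (flip-weaklyAbove p q k))

  flipLastRise : ∀ C → InIntervalE n d U (Ltr n d) C → 1 ≤ height 0 C →
                 Σ Word λ D → InIntervalN n d U (Ltr n d) D × st D ≡ st C
  flipLastRise C I C⁺ with riseView 0 C C⁺
  ... | lastRise p {q} hp q⁺ = p ++ 𝐞 ∷ q , flip-inInterval p q I , st-flip p q hp q⁺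

module _ (n d : ℕ) (U : Word) where

  𝒮ᵉ∩𝒮ⁿ : List ℕ → Set
  𝒮ᵉ∩𝒮ⁿ X = InSe n d U X × InSn n d U X

  𝒮ᵉ⊆𝒮 : ∀ {X} → InSe n d U X → InS n d U X
  𝒮ᵉ⊆𝒮 (C , I , stC≈X) with height 0 C in hC
  ... | zero = C ∷ʳ 𝐞 , I , subst (_≈ˢ _) (sym (st-∷ʳ-𝐞-marked C hC)) stC≈X
  ... | suc _ with flipLastRise C I (subst (1 ≤_) (sym hC) (s≤s z≤n))
  ...   | D , J , stD≡stC = D ∷ʳ 𝐧 , J , subst (_≈ˢ _) (sym (trans (st-∷ʳ-𝐧 D) stD≡stC)) stC≈X

  𝒮ⁿ⊆𝒮 : ∀ {X} → InSn n d U X → InS n d U X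
  𝒮ⁿ⊆𝒮 (C , I , stC≈X) = C ∷ʳ 𝐧 , I , subst (_≈ˢ _) (sym (st-∷ʳ-𝐧 C)) stC≈X

  st-∷ʳ-𝐞-raised : ∀ C {h} → InIntervalE n d U (Ltr n d) C → height 0 C ≡ suc h →
                   st (C ∷ʳ 𝐞) ≈ˢ (n ∷ st C)
  st-∷ʳ-𝐞-raised C ((len , _) , _) hC rewrite st-∷ʳ-𝐞-unmarked C hC =
    subst (λ m → (st C ∷ʳ suc (length C)) ≈ˢ (m ∷ st C)) (trans (sym (length-∷ʳ C 𝐞)) len) (≈ˢ-∷ʳ (st C) _)

  n∗𝒮ᵉ∩𝒮ⁿ⊆𝒮 : ∀ {X} σ → 𝒮ᵉ∩𝒮ⁿ σ → X ≈ˢ (n ∷ σ) → InS n d U X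
  n∗𝒮ᵉ∩𝒮ⁿ⊆𝒮 σ ((A , IA , stA≈σ) , (B , IB , stB≈σ)) X≈nσ =
    A ∷ʳ 𝐞 , IA ,
    ≈ˢ-trans (st-∷ʳ-𝐞-raised A IA hA) (≈ˢ-trans (≈ˢ-∷ n stA≈σ) (≈ˢ-sym X≈nσ))
    where
    hA = height-gap A B (proj₁ IA) (proj₁ IB) (≈ˢ-trans stA≈σ (≈ˢ-sym stB≈σ))

  𝒮ᵉ∪𝒮ⁿ∪n∗𝒮ᵉ∩𝒮ⁿ : List ℕ → Set
  𝒮ᵉ∪𝒮ⁿ∪n∗𝒮ᵉ∩𝒮ⁿ X =
    InSe n d U X ⊎ InSn n d U X ⊎ 𝒮ᵉ∩𝒮ⁿ X ⊎ Σ (List ℕ) (λ σ → 𝒮ᵉ∩𝒮ⁿ σ × (X ≈ˢ (n ∷ σ)))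

  𝒮ᵉ∪𝒮ⁿ∪n∗𝒮ᵉ∩𝒮ⁿ⊆𝒮 : ∀ {X} → 𝒮ᵉ∪𝒮ⁿ∪n∗𝒮ᵉ∩𝒮ⁿ X → InS n d U X
  𝒮ᵉ∪𝒮ⁿ∪n∗𝒮ᵉ∩𝒮ⁿ⊆𝒮 (inj₁ X∈𝒮ᵉ) = 𝒮ᵉ⊆𝒮 X∈𝒮ᵉ
  𝒮ᵉ∪𝒮ⁿ∪n∗𝒮ᵉ∩𝒮ⁿ⊆𝒮 (inj₂ (inj₁ X∈𝒮ⁿ)) = 𝒮ⁿ⊆𝒮 X∈𝒮ⁿ
  𝒮ᵉ∪𝒮ⁿ∪n∗𝒮ᵉ∩𝒮ⁿ⊆𝒮 (inj₂ (inj₂ (inj₁ (X∈𝒮ᵉ , _)))) = 𝒮ᵉ⊆𝒮 X∈𝒮ᵉ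
  𝒮ᵉ∪𝒮ⁿ∪n∗𝒮ᵉ∩𝒮ⁿ⊆𝒮 (inj₂ (inj₂ (inj₂ (σ , σ∈𝒮ᵉ∩𝒮ⁿ , X≈nσ)))) = n∗𝒮ᵉ∩𝒮ⁿ⊆𝒮 σ σ∈𝒮ᵉ∩𝒮ⁿ X≈nσ

  𝒮⊆𝒮ᵉ∪𝒮ⁿ∪n∗𝒮ᵉ∩𝒮ⁿ : ∀ {X} → 1 ≤ n → InS n d U X → 𝒮ᵉ∪𝒮ⁿ∪n∗𝒮ᵉ∩𝒮ⁿ X
  𝒮⊆𝒮ᵉ∪𝒮ⁿ∪n∗𝒮ᵉ∩𝒮ⁿ 1≤n (C , I , stC≈X) with initLast C
  ... | [] = contradiction (sym (proj₁ (proj₁ I))) (m<n⇒n≢0 1≤n)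
  ... | w ∷ʳ′ 𝐧 = inj₂ (inj₁ (w , I , subst (_≈ˢ _) (st-∷ʳ-𝐧 w) stC≈X))
  ... | w ∷ʳ′ 𝐞 with height 0 w in hw
  ...   | zero = inj₁ (w , I , subst (_≈ˢ _) (st-∷ʳ-𝐞-marked w hw) stC≈X)
  ...   | suc _ with flipLastRise w I (subst (1 ≤_) (sym hw) (s≤s z≤n))
  ...     | D , J , stD≡stw =
    inj₂ (inj₂ (inj₂ (st w , ((w , I , ≈ˢ-refl) , (D , J , subst (_≈ˢ _) (sym stD≡stw) ≈ˢ-refl))
                     , ≈ˢ-trans (≈ˢ-sym stC≈X) (st-∷ʳ-𝐞-raised w I hw))))

theorem4p11 : (n d : ℕ) → 1 ≤ n → (U : Word) → InP n d U →
    (X : List ℕ) →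
    InS n d U X ⇔
      (InSe n d U X ⊎ InSn n d U X ⊎
        (InSe n d U X × InSn n d U X) ⊎
        Σ (List ℕ) (λ σ → (InSe n d U σ × InSn n d U σ) × (X ≈ˢ (n ∷ σ))))
theorem4p11 n d 1≤n U _ X =
  mk⇔ (𝒮⊆𝒮ᵉ∪𝒮ⁿ∪n∗𝒮ᵉ∩𝒮ⁿ n d U 1≤n) (𝒮ᵉ∪𝒮ⁿ∪n∗𝒮ᵉ∩𝒮ⁿ⊆𝒮 n d U)
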